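{- If $f:\mathbb N\to\mathcal L(\mathbb N)$ is computable, then $f$ is disciplined with respect to the semidecidable propositions, i.e. $\big\lVert\sum_{g:\mathbb N\to\mathcal L_{\mathsf{SemiDecision}}(\mathbb N)}\operatorname{tame}(g)=f\big\rVert$.
   Context: Type theory: Martin-Löf type theory with universe $\mathcal U$, function extensionality, proposition extensionality and propositional truncations. $\mathcal L(Y):=\sum_{P:\mathcal U}\operatorname{isProp}(P)\times(P\to Y)$, $\eta(y)=(1,-,\lambda u.y)$. Recursive machine: a pair $m=(i,s)$ of unary primitive recursive functions, $s$ read as $\mathbb N\to\mathbb N+\mathbb N$ via $\mathrm{inl}(n)=2n$, $\mathrm{inr}(n)=2n+1$; $\operatorname{run}_k(m,x):=s'^k(\mathrm{inl}(i(x)))$ where $s'(\mathrm{inl}\,x)=s(x)$, $s'(\mathrm{inr}\,y)=\mathrm{inr}\,y$; $\operatorname{eval}(m)(x)$ has extent $\sum_y\lVert\sum_k\operatorname{run}_k(m,x)=\mathrm{inr}\,y\rVert$ and value the first projection; $f$ is computable if $\lVert\sum_m f=\operatorname{eval}(m)\rVert$; a total $h:\mathbb N\to2$ is computable if $\eta\circ h$ is. For $h:\mathbb N\to2$, $\langle h\rangle:=\sum_n(h_n=1)$. $\mathsf{SemiDecision}(P):=\sum_{h:\mathbb N\to2}\operatorname{isProp}\langle h\rangle\times\mathsf{isComputable}(h)\times(P\simeq\langle h\rangle)$. $\mathcal L_{\mathsf{SemiDecision}}(Y):=\sum_{P:\mathcal U}\mathsf{SemiDecision}(P)\times(P\to Y)$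 and $\operatorname{tame}(g):=e\circ g$ with $e(P,d,\varphi)=(P,-,\varphi)$. -}

{-# OPTIONS --without-K #-}
module Defs where

open import Level using (Level; _⊔_; Setω) renaming (suc to lsuc; zero to lzero)
open import Data.Nat using (ℕ; zero; suc; _+_; _∸_; _≤_; z≤n; s≤s)
open import Data.Nat.Properties using (≡-irrelevant; ≤-total; m∸n+n≡m)
open import Data.Fin using (Fin; toℕ)
open import Data.Fin.Patterns using (1F)
open import Data.Vec using (Vec; []; _∷_; lookup)
open import Data.Sum using (_⊎_; inj₁; inj₂)
import Data.Sum as Sum
open import Data.Product using (Σ; _×_; _,_; proj₁; proj₂)
open import Data.Unit using (⊤; tt)
open import Function.Bundles using (_↔_; Inverse)
open import Relation.Binary.PropositionalEquality
  using (_≡_; refl; sym; trans; cong; subst)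

isProp : ∀ {a} → Set a → Set a
isProp A = (x y : A) → x ≡ y

-- The ambient axioms of the paper: function extensionality, proposition
-- extensionality (for the universe 𝓤 = Set) and propositional truncations
-- (at every universe level).  They are taken as an explicit argument of
-- the theorem, since --safe forbids postulates.

record Axioms : Setω where
  field
    funext   : ∀ {a b} {A : Set a} {B : A → Set b} {f g : (x : A) → B x}
             → ((x : A) → f x ≡ g x) → f ≡ g
    propext  : {P Q : Set} → isProp P → isProp Q → (P → Q) → (Q → P) → P ≡ Q
    ∥_∥      : ∀ {a} → Set a → Set a
    ∣_∣      : ∀ {a} {A : Set a} → A → ∥ A ∥
    ∥∥-isProp : ∀ {a} {A : Set a} → isProp ∥ A ∥
    ∥∥-rec   : ∀ {a b} {A : Set a} {B : Set b} → isProp B → (A → B) → ∥ A ∥ → B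

data PR : ℕ → Set where
  zer  : ∀ {n} → PR n
  succ : PR 1
  proj : ∀ {n} → Fin n → PR n
  comp : ∀ {m n} → PR m → Vec (PR n) m → PR n
  prec : ∀ {n} → PR n → PR (suc (suc n)) → PR (suc n)

mutual
  ⟦_⟧ : ∀ {n} → PR n → Vec ℕ n → ℕ
  ⟦ zer ⟧ xs = 0
  ⟦ succ ⟧ (x ∷ []) = suc x
  ⟦ proj i ⟧ xs = lookup xs i
  ⟦ comp f gs ⟧ xs = ⟦ f ⟧ (⟦ gs ⟧* xs)
  ⟦ prec g h ⟧ (zero ∷ xs) = ⟦ g ⟧ xs
  ⟦ prec g h ⟧ (suc k ∷ xs) = ⟦ h ⟧ (k ∷ ⟦ prec g h ⟧ (k ∷ xs) ∷ xs)

  ⟦_⟧* : ∀ {m n} → Vec (PR n) m → Vec ℕ n → Vec ℕ m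
  ⟦ [] ⟧* xs = []
  ⟦ g ∷ gs ⟧* xs = ⟦ g ⟧ xs ∷ ⟦ gs ⟧* xs

⟦_⟧₁ : PR 1 → ℕ → ℕ
⟦ p ⟧₁ x = ⟦ p ⟧ (x ∷ [])

-- ℕ read as ℕ + ℕ via inl n = 2n, inr n = 2n+1
decode : ℕ → ℕ ⊎ ℕ
decode zero = inj₁ 0
decode (suc zero) = inj₂ 0
decode (suc (suc n)) = Sum.map suc suc (decode n)

Machine : Set
Machine = PR 1 × PR 1

step' : Machine → ℕ ⊎ ℕ → ℕ ⊎ ℕ
step' (i , s) (inj₁ x) = decode (⟦ s ⟧₁ x)
step' (i , s) (inj₂ y) = inj₂ y

iter : Machine → ℕ → ℕ ⊎ ℕ → ℕ ⊎ ℕ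
iter m zero a = a
iter m (suc k) a = step' m (iter m k a)

run : ℕ → Machine → ℕ → ℕ ⊎ ℕ
run k m x = iter m k (inj₁ (⟦ proj₁ m ⟧₁ x))

private
  iter-add : ∀ m {a y} k j → iter m k a ≡ inj₂ y → iter m (j + k) a ≡ inj₂ y
  iter-add m k zero e = e
  iter-add m k (suc j) e rewrite iter-add m k j e = refl

  iter-stays : ∀ m {a y} k k' → k ≤ k' → iter m k a ≡ inj₂ y → iter m k' a ≡ inj₂ y
  iter-stays m {a} {y} k k' le e =
    subst (λ n → iter m n a ≡ inj₂ y) (m∸n+n≡m le) (iter-add m k (k' ∸ k) e)

  inj₂-inj : ∀ {y y' : ℕ} → inj₂ {A = ℕ} y ≡ inj₂ y' → y ≡ y'
  inj₂-inj refl = refl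

  run-det : ∀ m x {y y'} k k' → run k m x ≡ inj₂ y → run k' m x ≡ inj₂ y' → y ≡ y'
  run-det m x k k' e e' with ≤-total k k'
  ... | inj₁ le = inj₂-inj (trans (sym (iter-stays m k k' le e)) e')
  ... | inj₂ le = inj₂-inj (trans (sym e) (iter-stays m k' k le e'))

module WithAxioms (ax : Axioms) where
  open Axioms ax public

  𝓛 : ∀ {b} → Set b → Set (lsuc lzero ⊔ b)
  𝓛 Y = Σ Set (λ P → isProp P × (P → Y))

  η : ∀ {b} {Y : Set b} → Y → 𝓛 Y
  η y = ⊤ , (λ _ _ → refl) , (λ _ → y)

  Extent : Machine → ℕ → Set
  Extent m x = Σ ℕ (λ y → ∥ Σ ℕ (λ k → run k m x ≡ inj₂ y) ∥)

  Extent-isProp : ∀ m x → isProp (Extent m x)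
  Extent-isProp m x (y , a) (y' , b) = pair y y' a b
    (∥∥-rec (λ p q → ≡-irrelevant p q)
      (λ { (k , e) → ∥∥-rec (λ p q → ≡-irrelevant p q)
                       (λ { (k' , e') → run-det m x k k' e e' }) b }) a)
    where
    pair : ∀ y y' a b → y ≡ y' → _≡_ {A = Extent m x} (y , a) (y' , b)
    pair y .y a b refl = cong (y ,_) (∥∥-isProp a b)

  eval : Machine → ℕ → 𝓛 ℕ
  eval m x = Extent m x , Extent-isProp m x , proj₁

  isComputable : (ℕ → 𝓛 ℕ) → Set₁
  isComputable f = ∥ Σ Machine (λ m → f ≡ eval m) ∥

  isComputable₂ : (ℕ → Fin 2) → Set₁
  isComputable₂ h = isComputable (λ n → η (toℕ (h n)))

  ⟨_⟩ : (ℕ → Fin 2) → Set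
  ⟨ h ⟩ = Σ ℕ (λ n → h n ≡ 1F)

  SemiDecision : Set → Set₁
  SemiDecision P = Σ (ℕ → Fin 2) (λ h →
    isProp ⟨ h ⟩ × isComputable₂ h × (P ↔ ⟨ h ⟩))

  𝓛SD : Set → Set₁
  𝓛SD Y = Σ Set (λ P → SemiDecision P × (P → Y))

  SemiDecision⇒isProp : ∀ {P} → SemiDecision P → isProp P
  SemiDecision⇒isProp (h , pr , c , eq) x y =
    trans (sym (Inverse.strictlyInverseʳ eq x))
      (trans (cong (Inverse.from eq) (pr (Inverse.to eq x) (Inverse.to eq y)))
             (Inverse.strictlyInverseʳ eq y))

  e : 𝓛SD ℕ → 𝓛 ℕ
  e (P , d , φ) = P , SemiDecision⇒isProp d , φ

  tame : (ℕ → 𝓛SD ℕ) → (ℕ → 𝓛 ℕ)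
  tame g = λ n → e (g n)

  DisciplinedSD : (ℕ → 𝓛 ℕ) → Set₁
  DisciplinedSD f = ∥ Σ (ℕ → 𝓛SD ℕ) (λ g → tame g ≡ f) ∥

-- The extent of eval(m)(x) says that the run of m on x halts at some step.
-- A primitive recursive function can simulate any fixed number k of steps,
-- so the bit "the run has halted by step k" is primitive recursive in k.
-- Since halting is permanent, this bit sequence rises from 0 to 1 at most
-- once, and the sequence h marking that rise is a computable semidecision
-- of the extent with at most one witness.  Equipping every eval(m)(x) with
-- it yields a g : ℕ → 𝓛_SemiDecision(ℕ) with tame g = eval m.
module Submission where

open import Defs
open import Data.Nat using (ℕ; zero; suc; _+_; _<_; _≤′_; ≤′-refl; ≤′-step)
open import Data.Nat.Properties using (+-suc; +-identityʳ; +-comm; <-cmp; ≤⇒≤′)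
open import Data.Fin using (Fin; toℕ; _≟_)
open import Data.Fin.Patterns using (0F; 1F; 3F)
open import Data.Vec using ([]; _∷_)
open import Data.Sum using (_⊎_; inj₁; inj₂; [_,_]′)
import Data.Sum as Sum
open import Data.Product using (Σ; _×_; _,_; proj₁; proj₂)
open import Data.Unit using (tt)
open import Data.Empty using (⊥; ⊥-elim)
open import Function using (_∘_; const)
open import Function.Bundles using (_↔_; mk↔ₛ′)
open import Relation.Binary using (tri<; tri≈; tri>)
open import Relation.Binary.PropositionalEquality
  using (_≡_; refl; sym; trans; cong; cong₂; subst)
open import Axiom.UniquenessOfIdentityProofs using (UIP; module Constant⇒UIP; module Decidable⇒UIP)

constP : ℕ → ∀ {n} → PR n
constP zero = zer
constP (suc c) = comp succ (constP c ∷ [])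

constP-correct : ∀ c {n} xs → ⟦ constP c {n} ⟧ xs ≡ c
constP-correct zero xs = refl
constP-correct (suc c) xs = cong suc (constP-correct c xs)

-- ifZeroP (c , a , b) = a if c = 0, and b otherwise
ifZeroP : PR 3
ifZeroP = prec (proj 0F) (proj 3F)

notP : PR 1
notP = prec (constP 1) zer

addP : PR 2
addP = prec (proj 0F) (comp succ (proj 1F ∷ []))

addP-correct : ∀ a b → ⟦ addP ⟧ (a ∷ b ∷ []) ≡ a + b
addP-correct zero b = refl
addP-correct (suc a) b = cong suc (addP-correct a b)

doubleP : PR 1
doubleP = comp addP (proj 0F ∷ proj 0F ∷ [])

parityP : PR 1
parityP = prec zer (comp notP (proj 1F ∷ []))

halfP : PR 1
halfP = prec zer (comp addP (proj 1F ∷ comp parityP (proj 0F ∷ []) ∷ []))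

encode : ℕ ⊎ ℕ → ℕ
encode (inj₁ a) = a + a
encode (inj₂ a) = suc (a + a)

decode-encode : ∀ v → decode (encode v) ≡ v
decode-encode (inj₁ zero) = refl
decode-encode (inj₂ zero) = refl
decode-encode (inj₁ (suc a)) =
  trans (cong (decode ∘ suc) (+-suc a a)) (cong (Sum.map suc suc) (decode-encode (inj₁ a)))
decode-encode (inj₂ (suc a)) =
  trans (cong (decode ∘ suc ∘ suc) (+-suc a a)) (cong (Sum.map suc suc) (decode-encode (inj₂ a)))

encode-map-suc : ∀ v → encode (Sum.map suc suc v) ≡ suc (suc (encode v))
encode-map-suc (inj₁ a) = cong suc (+-suc a a)
encode-map-suc (inj₂ a) = cong (suc ∘ suc) (+-suc a a)

encode-decode : ∀ c → encode (decode c) ≡ c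
encode-decode zero = refl
encode-decode (suc zero) = refl
encode-decode (suc (suc c)) =
  trans (encode-map-suc (decode c)) (cong (suc ∘ suc) (encode-decode c))

doubleP-correct : ∀ a → ⟦ doubleP ⟧₁ a ≡ encode (inj₁ a)
doubleP-correct a = addP-correct a a

parityP-even : ∀ a → ⟦ parityP ⟧₁ (encode (inj₁ a)) ≡ 0
parityP-odd : ∀ a → ⟦ parityP ⟧₁ (encode (inj₂ a)) ≡ 1

parityP-even zero = refl
parityP-even (suc a) rewrite +-suc a a | parityP-odd a = refl
parityP-odd a rewrite parityP-even a = refl

halfP-even : ∀ a → ⟦ halfP ⟧₁ (encode (inj₁ a)) ≡ a
halfP-odd : ∀ a → ⟦ halfP ⟧₁ (encode (inj₂ a)) ≡ a

halfP-even zero = refl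
halfP-even (suc a) rewrite +-suc a a
  | addP-correct (⟦ halfP ⟧₁ (suc (a + a))) (⟦ parityP ⟧₁ (suc (a + a)))
  | halfP-odd a | parityP-odd a = +-comm a 1
halfP-odd a
  rewrite addP-correct (⟦ halfP ⟧₁ (a + a)) (⟦ parityP ⟧₁ (a + a))
  | halfP-even a | parityP-even a = +-identityʳ a

-- one machine step on codes: an odd code is a halted state and is kept
stepP : PR 1 → PR 1
stepP s = comp ifZeroP (parityP ∷ comp s (halfP ∷ []) ∷ proj 0F ∷ [])

stepP-correct : ∀ i s v → ⟦ stepP s ⟧₁ (encode v) ≡ encode (step' (i , s) v)
stepP-correct i s (inj₁ a) rewrite parityP-even a | halfP-even a =
  sym (encode-decode (⟦ s ⟧₁ a))
stepP-correct i s (inj₂ a) rewrite parityP-odd a = refl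

runP : Machine → ℕ → PR 1
runP (i , s) x = prec (comp doubleP (comp i (constP x ∷ []) ∷ []))
                      (comp (stepP s) (proj 1F ∷ []))

runP-correct : ∀ m x k → ⟦ runP m x ⟧₁ k ≡ encode (run k m x)
runP-correct (i , s) x zero rewrite constP-correct x [] = doubleP-correct (⟦ i ⟧₁ x)
runP-correct (i , s) x (suc k) rewrite runP-correct (i , s) x k =
  stepP-correct i s (run k (i , s) x)

rise : Fin 2 → Fin 2 → Fin 2
rise 0F 1F = 1F
rise 0F 0F = 0F
rise 1F _ = 0F

rise≡1F : ∀ {a b} → rise a b ≡ 1F → a ≡ 0F × b ≡ 1F
rise≡1F {0F} {1F} _ = refl , refl
rise≡1F {0F} {0F} ()
rise≡1F {1F} ()

riseP : PR 2
riseP = comp ifZeroP (proj 1F ∷ zer ∷ comp notP (proj 0F ∷ []) ∷ [])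

riseP-correct : ∀ a b → ⟦ riseP ⟧ (toℕ a ∷ toℕ b ∷ []) ≡ toℕ (rise a b)
riseP-correct 0F 0F = refl
riseP-correct 0F 1F = refl
riseP-correct 1F 0F = refl
riseP-correct 1F 1F = refl

rises : (ℕ → Fin 2) → ℕ → Fin 2
rises t n = rise (t n) (t (suc n))

Monotone : (ℕ → Fin 2) → Set
Monotone t = ∀ n → t n ≡ 1F → t (suc n) ≡ 1F

module _ {t : ℕ → Fin 2} (mono : Monotone t) where

  monotone-≤′ : ∀ {m n} → m ≤′ n → t m ≡ 1F → t n ≡ 1F
  monotone-≤′ ≤′-refl p = p
  monotone-≤′ (≤′-step le) p = mono _ (monotone-≤′ le p)

  rises-ordered : ∀ {m n} → m < n → rises t m ≡ 1F → rises t n ≡ 1F → ⊥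
  rises-ordered m<n p q
    with trans (sym (proj₁ (rise≡1F q))) (monotone-≤′ (≤⇒≤′ m<n) (proj₂ (rise≡1F p)))
  ... | ()

  rises-unique : ∀ {m n} → rises t m ≡ 1F → rises t n ≡ 1F → m ≡ n
  rises-unique {m} {n} p q with <-cmp m n
  ... | tri< m<n _ _ = ⊥-elim (rises-ordered m<n p q)
  ... | tri≈ _ m≡n _ = m≡n
  ... | tri> _ _ n<m = ⊥-elim (rises-ordered n<m q p)

  rises-isProp : isProp (Σ ℕ λ n → rises t n ≡ 1F)
  rises-isProp (m , p) (n , q) with rises-unique p q
  ... | refl = cong (m ,_) (Decidable⇒UIP.≡-irrelevant _≟_ p q)

first-rise : ∀ {t : ℕ → Fin 2} k → t 0 ≡ 0F → t k ≡ 1F → Σ ℕ λ n → rises t n ≡ 1F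
first-rise zero t0 tk with trans (sym t0) tk
... | ()
first-rise {t} (suc k) t0 tk with t k in tk'
... | 0F = k , cong₂ rise tk' tk
... | 1F = first-rise k t0 tk'

tag : ℕ ⊎ ℕ → Fin 2
tag = [ const 0F , const 1F ]′

tag≡1F : ∀ {v} → tag v ≡ 1F → Σ ℕ λ y → v ≡ inj₂ y
tag≡1F {inj₂ y} _ = y , refl
tag≡1F {inj₁ _} ()

parityP-correct : ∀ v → ⟦ parityP ⟧₁ (encode v) ≡ toℕ (tag v)
parityP-correct (inj₁ a) = parityP-even a
parityP-correct (inj₂ a) = parityP-odd a

halted : Machine → ℕ → ℕ → Fin 2
halted m x k = tag (run k m x)

halted-monotone : ∀ m x → Monotone (halted m x)
halted-monotone (i , s) x k p with run k (i , s) x | p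
... | inj₂ y | _ = refl
... | inj₁ _ | ()

-- haltingStep m x n = 1F iff the run first halts at step suc n; run 0 never halts
haltingStep : Machine → ℕ → ℕ → Fin 2
haltingStep m x = rises (halted m x)

haltedP : Machine → ℕ → PR 1
haltedP m x = comp parityP (runP m x ∷ [])

haltedP-correct : ∀ m x k → ⟦ haltedP m x ⟧₁ k ≡ toℕ (halted m x k)
haltedP-correct m x k rewrite runP-correct m x k = parityP-correct (run k m x)

haltingStepP : Machine → ℕ → PR 1
haltingStepP m x = comp riseP (haltedP m x ∷ comp (haltedP m x) (succ ∷ []) ∷ [])

haltingStepP-correct : ∀ m x n → ⟦ haltingStepP m x ⟧₁ n ≡ toℕ (haltingStep m x n)
haltingStepP-correct m x n =
  trans (cong₂ (λ a b → ⟦ riseP ⟧ (a ∷ b ∷ []))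
               (haltedP-correct m x n) (haltedP-correct m x (suc n)))
        (riseP-correct (halted m x n) (halted m x (suc n)))

haltP : PR 1
haltP = comp succ (doubleP ∷ [])

run-haltP : ∀ p n → run 1 (p , haltP) n ≡ inj₂ (⟦ p ⟧₁ n)
run-haltP p n =
  trans (cong (decode ∘ suc) (doubleP-correct (⟦ p ⟧₁ n))) (decode-encode (inj₂ (⟦ p ⟧₁ n)))

module Semidecision (ax : Axioms) where
  open WithAxioms ax

  isProp⇒UIP : ∀ {a} {P : Set a} → isProp P → UIP P
  isProp⇒UIP ip = Constant⇒UIP.≡-irrelevant (λ {x} {y} _ → ip x y) (λ _ _ → refl)

  isProp-isProp : ∀ {a} {P : Set a} → isProp (isProp P)
  isProp-isProp ip iq = funext λ x → funext λ y → isProp⇒UIP ip (ip x y) (iq x y)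

  𝓛-≡ : ∀ {Y P Q : Set} {ip : isProp P} {iq : isProp Q} {φ : P → Y} {ψ : Q → Y}
      → (P → Q) → (Q → P) → (∀ p q → φ p ≡ ψ q)
      → _≡_ {A = 𝓛 Y} (P , ip , φ) (Q , iq , ψ)
  𝓛-≡ {ip = ip} {iq} to from φ≡ψ with propext ip iq to from
  ... | refl = cong₂ (λ ip′ φ′ → _ , ip′ , φ′) (isProp-isProp ip iq) (funext λ p → φ≡ψ p p)

  halting⇒η≡eval : ∀ {m x y} k → run k m x ≡ inj₂ y → η y ≡ eval m x
  halting⇒η≡eval {m} {x} {y} k r =
    𝓛-≡ (λ _ → halts) (λ _ → tt) (λ _ q → cong proj₁ (Extent-isProp m x halts q))
    where
    halts : Extent m x
    halts = y , ∣ k , r ∣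

  PR-isComputable : (p : PR 1) → isComputable (η ∘ ⟦ p ⟧₁)
  PR-isComputable p = ∣ (p , haltP) , funext (λ n → halting⇒η≡eval 1 (run-haltP p n)) ∣

  haltingStep-isComputable : ∀ m x → isComputable₂ (haltingStep m x)
  haltingStep-isComputable m x =
    subst isComputable (funext λ n → cong η (haltingStepP-correct m x n))
          (PR-isComputable (haltingStepP m x))

  Extent↔⟨haltingStep⟩ : ∀ m x → Extent m x ↔ ⟨ haltingStep m x ⟩
  Extent↔⟨haltingStep⟩ m x =
    mk↔ₛ′ to from (λ _ → rises-isProp (halted-monotone m x) _ _)
                  (λ _ → Extent-isProp m x _ _)
    where
    to : Extent m x → ⟨ haltingStep m x ⟩
    to (y , halts) = ∥∥-rec (rises-isProp (halted-monotone m x))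
                            (λ (k , r) → first-rise k refl (cong tag r)) halts
    from : ⟨ haltingStep m x ⟩ → Extent m x
    from (n , p) with tag≡1F (proj₂ (rise≡1F p))
    ... | y , r = y , ∣ suc n , r ∣

  Extent-semiDecision : ∀ m x → SemiDecision (Extent m x)
  Extent-semiDecision m x =
    haltingStep m x , rises-isProp (halted-monotone m x) ,
    haltingStep-isComputable m x , Extent↔⟨haltingStep⟩ m x

  evalSD : Machine → ℕ → 𝓛SD ℕ
  evalSD m x = Extent m x , Extent-semiDecision m x , proj₁

  tame-evalSD : ∀ m → tame (evalSD m) ≡ eval m
  tame-evalSD m = funext λ x → cong (λ ip → Extent m x , ip , proj₁) (isProp-isProp _ _)

corollary9p5 : (ax : Axioms) → let open WithAxioms ax in
    (f : ℕ → 𝓛 ℕ) → isComputable f → DisciplinedSD f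
corollary9p5 ax f f-computable =
  ∥∥-rec ∥∥-isProp (λ (m , f≡eval) → ∣ evalSD m , trans (tame-evalSD m) (sym f≡eval) ∣)
         f-computable
  where
  open WithAxioms ax
  open Semidecision ax
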